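{- Let $D$ be a strongly connected digraph of order $n$ and girth $g$. Then $\chi_A(D)\leq\left\lceil\frac{n}{g-1}\right\rceil$.
   Context: All digraphs are finite and loopless. Strongly connected: directed path between any ordered pair of distinct vertices. Girth: length of a shortest directed cycle. $\chi_A(D)$ is the minimum number of colors in a vertex coloring of $D$ whose color classes induce no directed cycle. -}

module Defs where

open import Data.Nat using (ℕ; zero; suc; _+_; _*_; _∸_; _≤_; _<_)
open import Data.Nat.DivMod using (_/_)
open import Data.Bool using (Bool; true; false; T)
open import Data.Fin using (Fin; zero; suc; fromℕ; inject₁)
open import Data.Product using (Σ; ∃; _×_; _,_)
open import Function.Definitions using (Injective)
open import Relation.Binary.PropositionalEquality using (_≡_; _≢_)

record Digraph (n : ℕ) : Set where
  field
    adj      : Fin n → Fin n → Bool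
    loopless : ∀ v → adj v v ≡ false

open Digraph public

Arc : ∀ {n} → Digraph n → Fin n → Fin n → Set
Arc D u v = T (adj D u v)

DirPath : ∀ {n} → Digraph n → Fin n → Fin n → Set
DirPath {n} D u v =
  Σ ℕ λ k → Σ (Fin (suc k) → Fin n) λ f →
    Injective _≡_ _≡_ f × f zero ≡ u × f (fromℕ k) ≡ v ×
    (∀ (i : Fin k) → Arc D (f (inject₁ i)) (f (suc i)))

StronglyConnected : ∀ {n} → Digraph n → Set
StronglyConnected {n} D = ∀ (u v : Fin n) → u ≢ v → DirPath D u v

DirCycleIn : ∀ {n} → Digraph n → (Fin n → Set) → ℕ → Set
DirCycleIn {n} D P zero = Data.Empty.⊥
  where import Data.Empty
DirCycleIn {n} D P (suc m) =
  1 ≤ m × Σ (Fin (suc m) → Fin n) λ c →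
    Injective _≡_ _≡_ c ×
    (∀ (i : Fin m) → Arc D (c (inject₁ i)) (c (suc i))) ×
    Arc D (c (fromℕ m)) (c zero) ×
    (∀ i → P (c i))

DirCycle : ∀ {n} → Digraph n → ℕ → Set
DirCycle D ℓ = DirCycleIn D (λ _ → Data.Unit.⊤) ℓ
  where import Data.Unit

Girth : ∀ {n} → Digraph n → ℕ → Set
Girth D g = DirCycle D g × (∀ ℓ → DirCycle D ℓ → g ≤ ℓ)

-- acyclic colouring with k colours: no colour class contains (hence induces) a directed cycle
AcyclicColoring : ∀ {n} → Digraph n → ℕ → Set
AcyclicColoring {n} D k =
  Σ (Fin n → Fin k) λ col → ∀ (a : Fin k) (ℓ : ℕ) → ¬ DirCycleIn D (λ v → col v ≡ a) ℓ
  where open import Relation.Nullary using (¬_)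

IsDichromaticNumber : ∀ {n} → Digraph n → ℕ → Set
IsDichromaticNumber D k = AcyclicColoring D k × (∀ j → j < k → ¬ AcyclicColoring D j)
  where open import Relation.Nullary using (¬_)

-- ⌈ n / d ⌉ for d ≥ 1 (junk value 0 for d = 0)
⌈_/_⌉ : ℕ → ℕ → ℕ
⌈ n / zero ⌉ = 0
⌈ n / suc d ⌉ = (n + d) / suc d

{-# OPTIONS --safe #-}
module Submission where

-- Cut the vertices into ⌈n/(g−1)⌉ blocks of at most g−1 vertices and give each
-- block its own colour: a directed cycle has at least g distinct vertices, so
-- no colour class contains one.

open import Defs
open import Data.Nat using (ℕ; zero; suc; _+_; _*_; _≤_; _∸_; s≤s⁻¹)
open import Data.Nat.Properties using (≮⇒≥; <⇒≱; +-cancelʳ-≤; +-comm; +-monoˡ-≤; module ≤-Reasoning)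
open import Data.Nat.DivMod using (_/_; _%_; m≡m%n+[m/n]*n; m%n<n)
open import Data.Fin using (Fin; inject≤; remQuot; combine)
open import Data.Fin.Properties using (injective⇒≤; inject≤-injective; combine-remQuot)
open import Data.Product using (_×_; _,_; proj₁; proj₂; uncurry)
open import Data.Unit using (tt)
open import Function.Definitions using (Injective)
open import Relation.Binary.PropositionalEquality using (_≡_; sym; trans; cong; cong₂; module ≡-Reasoning)

n≤⌈n/d⌉*d : ∀ n d → n ≤ ⌈ n / suc d ⌉ * suc d
n≤⌈n/d⌉*d n d = +-cancelʳ-≤ d n _ (begin
  n + d                                   ≡⟨ m≡m%n+[m/n]*n (n + d) (suc d) ⟩
  (n + d) % suc d + ⌈ n / suc d ⌉ * suc d  ≤⟨ +-monoˡ-≤ _ (s≤s⁻¹ (m%n<n (n + d) (suc d))) ⟩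
  d + ⌈ n / suc d ⌉ * suc d                ≡⟨ +-comm d _ ⟩
  ⌈ n / suc d ⌉ * suc d + d                ∎)
  where open ≤-Reasoning

remQuot-injective : ∀ {m} d → Injective _≡_ _≡_ (remQuot {m} d)
remQuot-injective {m} d {i} {j} eq = begin
  i                                 ≡⟨ sym (combine-remQuot {m} d i) ⟩
  uncurry combine (remQuot {m} d i) ≡⟨ cong (uncurry combine) eq ⟩
  uncurry combine (remQuot {m} d j) ≡⟨ combine-remQuot {m} d j ⟩
  j                                 ∎
  where open ≡-Reasoning

module _ {n : ℕ} (D : Digraph n) where

  DirCycleIn⇒DirCycle : ∀ {P : Fin n → Set} {ℓ} → DirCycleIn D P ℓ → DirCycle D ℓ
  DirCycleIn⇒DirCycle {ℓ = suc m} (1≤m , c , c-inj , arcs , back , _) =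
    1≤m , c , c-inj , arcs , back , λ _ → tt

  DirCycleIn-length-≤ : ∀ {P : Fin n → Set} {d} (r : Fin n → Fin d) →
    (∀ {u v} → P u → P v → r u ≡ r v → u ≡ v) →
    ∀ {ℓ} → DirCycleIn D P ℓ → ℓ ≤ d
  DirCycleIn-length-≤ r r-inj {suc m} (_ , c , c-inj , _ , _ , c∈P) =
    injective⇒≤ λ {i} {j} e → c-inj (r-inj (c∈P i) (c∈P j) e)

  classes-embed⇒acyclic : ∀ {k d} (col : Fin n → Fin k) (r : Fin n → Fin d) →
    (∀ {u v} → col u ≡ col v → r u ≡ r v → u ≡ v) →
    (∀ ℓ → DirCycle D ℓ → suc d ≤ ℓ) →
    AcyclicColoring D k
  classes-embed⇒acyclic col r sep girth>d = col , λ a ℓ cyc →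
    <⇒≱ (girth>d ℓ (DirCycleIn⇒DirCycle cyc))
        (DirCycleIn-length-≤ r (λ u∈a v∈a → sep (trans u∈a (sym v∈a))) cyc)

  dichromatic-≤ : ∀ {χ k} → IsDichromaticNumber D χ → AcyclicColoring D k → χ ≤ k
  dichromatic-≤ (_ , minimal) acyclic = ≮⇒≥ λ k<χ → minimal _ k<χ acyclic

-- Vertex v is sent to (⌊v/(d+1)⌋ , v mod (d+1)), computed by remQuot after padding Fin n into Fin (⌈n/(d+1)⌉·(d+1)).
blocks : ∀ n d → Fin n → Fin ⌈ n / suc d ⌉ × Fin (suc d)
blocks n d v = remQuot (suc d) (inject≤ v (n≤⌈n/d⌉*d n d))

blocks-injective : ∀ n d → Injective _≡_ _≡_ (blocks n d)
blocks-injective n d e = inject≤-injective _ _ _ _ (remQuot-injective (suc d) e)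

corollary5 : (n : ℕ) (D : Digraph n) (g : ℕ) (χ : ℕ) →
    StronglyConnected D → Girth D g → IsDichromaticNumber D χ →
    χ ≤ ⌈ n / (g ∸ 1) ⌉
corollary5 n D zero χ _ (() , _) _
corollary5 n D (suc zero) χ _ ((() , _) , _) _
corollary5 n D (suc (suc d)) χ _ (_ , shortest) dichromatic =
  dichromatic-≤ D dichromatic
    (classes-embed⇒acyclic D (λ v → proj₁ (blocks n d v)) (λ v → proj₂ (blocks n d v))
      (λ same-block same-offset → blocks-injective n d (cong₂ _,_ same-block same-offset))
      shortest)
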